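{- For every positive integer $n$, if the home state of $SR_n$ is taken to be the fully horizontal state, then the poset of states of $SR_n$ is a distributive lattice.
   Context: The robotic arm $SR_n$: $n$ unit links in the strip $[0,n]\times[0,1]$, base at $(0,0)$, each facing north, south or east, never revisiting a point; states correspond to spread-out subsets $A\subseteq[n]$ (indices of vertical links, no two consecutive). Moves: two consecutive links facing different directions interchange directions, provided the result is a valid position; the last link rotates $90^\circ$ between horizontal and vertical, provided the result is valid. The transition graph has states as vertices and an edge between states differing by one move. Given a home state $u$, the poset of states is defined by $p\le q$ iff some shortest edge-path in the transition graph from $u$ to $q$ passes through $p$. -}

module Defs where

open import Data.Nat using (ℕ; zero; suc; _+_) renaming (_≤_ to _≤ℕ_)
open import Data.Integer using (ℤ; +_; _-_; _≤_)
open import Data.Product using (Σ; ∃; ∃₂; _×_; _,_; proj₁)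
open import Data.Sum using (_⊎_)
open import Data.Vec using (Vec; []; _∷_; replicate; toList)
open import Data.List using (List; []; _∷_)
open import Data.List.Relation.Unary.All using (All)
open import Data.List.Relation.Unary.Unique.Propositional using (Unique)
open import Relation.Binary.PropositionalEquality using (_≡_; _≢_)

data Dir : Set where
  N S E : Dir

Point : Set
Point = ℤ × ℤ

step : Dir → Point → Point
step N (x , y) = (x , y Data.Integer.+ + 1)
step S (x , y) = (x , y - + 1)
step E (x , y) = (x Data.Integer.+ + 1 , y)

points : ∀ {n} → Point → Vec Dir n → List Point
points p [] = p ∷ []
points p (d ∷ ds) = p ∷ points (step d p) ds

InStrip : ℕ → Point → Set
InStrip n (x , y) = (+ 0 ≤ x × x ≤ + n) × (+ 0 ≤ y × y ≤ + 1)

Valid : ∀ n → Vec Dir n → Set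
Valid n v = All (InStrip n) (points (+ 0 , + 0) v) × Unique (points (+ 0 , + 0) v)

State : ℕ → Set
State n = Σ (Vec Dir n) (Valid n)

_≈S_ : ∀ {n} → State n → State n → Set
s ≈S t = proj₁ s ≡ proj₁ t

data Swap : ∀ {n} → Vec Dir n → Vec Dir n → Set where
  here  : ∀ {n} {d e} {ds : Vec Dir n} → d ≢ e → Swap (d ∷ e ∷ ds) (e ∷ d ∷ ds)
  there : ∀ {n} {d} {ds es : Vec Dir n} → Swap ds es → Swap (d ∷ ds) (d ∷ es)

data Rot90 : Dir → Dir → Set where
  EN : Rot90 E N
  ES : Rot90 E S
  NE : Rot90 N E
  SE : Rot90 S E

data LastRot : ∀ {n} → Vec Dir n → Vec Dir n → Set where
  here  : ∀ {d e} → Rot90 d e → LastRot (d ∷ []) (e ∷ [])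
  there : ∀ {n} {d} {ds es : Vec Dir n} → LastRot ds es → LastRot (d ∷ ds) (d ∷ es)

Move : ∀ {n} → Vec Dir n → Vec Dir n → Set
Move v w = Swap v w ⊎ LastRot v w

-- Walk v u k : an edge-path of length k in the transition graph from v to u
-- (every position visited after the start is valid; the start is assumed valid).
data Walk {n : ℕ} : Vec Dir n → Vec Dir n → ℕ → Set where
  stay : ∀ {v} → Walk v v 0
  move : ∀ {v w u k} → Move v w → Valid n w → Walk w u k → Walk v u (suc k)

-- Poset with home state u: p ≤ q iff some shortest edge-path from u to q passes
-- through p, i.e. there are walks u → p (length a) and p → q (length b) with a + b
-- at most the length of every walk u → q.
Below : ∀ {n} → Vec Dir n → Vec Dir n → Vec Dir n → Set
Below {n} u p q = ∃₂ λ a b → Walk u p a × Walk p q b × (∀ k → Walk u q k → a + b ≤ℕ k)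

horizontal : ∀ n → Vec Dir n
horizontal n = replicate n E

_≤H_ : ∀ {n} → State n → State n → Set
_≤H_ {n} s t = Below (horizontal n) (proj₁ s) (proj₁ t)

-- Record a position by its profile: x ↦ the number of vertical links among its first
-- x links.  Valid positions correspond to the profiles that rise by steps of at most
-- one, never at two consecutive places; the direction of each vertical link is then
-- forced by the parity of the number of earlier ones.  A move changes the profile at a
-- single place by one, so the rank Σₓ profile(x) changes by exactly one; conversely, if
-- p lies pointwise below q ≠ p, then beyond their common prefix p has a horizontal link
-- where q has a vertical one, and shifting the next vertical link of p one step west
-- (or raising its last link) is a move up that stays below q.  Hence the distance from
-- the horizontal position is the rank, and p ≤ q iff the profile of p lies pointwise
-- below that of q.  Pointwise max and min preserve profiles, so the poset embeds as a
-- sublattice of the distributive lattice ℕ → ℕ.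

module Submission where

open import Defs
open import Data.Nat using (ℕ; zero; suc; _+_; _*_; _∸_; _≤_; _<_; _⊔_; _⊓_; z≤n; s≤s; s≤s⁻¹)
open import Data.Nat.Properties
open import Data.Integer as ℤ using (ℤ; +_; +≤+)
open import Data.Bool using (Bool; true; false)
open import Data.Empty using (⊥-elim)
open import Data.Product using (∃-syntax; ∃₂; _×_; _,_; proj₁; proj₂)
open import Data.Sum as Sum using (_⊎_; inj₁; inj₂)
open import Data.Vec using (Vec; []; _∷_)
open import Data.List.Relation.Unary.All as All using (All; []; _∷_)
open import Data.List.Relation.Unary.AllPairs using ([]; _∷_)
open import Data.List.Relation.Unary.Unique.Propositional using (Unique)
open import Relation.Binary.PropositionalEquality
open import Function using (_∘_)
open import Algebra.Core using (Op₂)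
open import Relation.Binary.Structures using (IsPartialOrder)
open import Relation.Binary.Lattice.Definitions using (Supremum; Infimum)
open import Relation.Binary.Lattice.Structures using (IsDistributiveLattice)
open import Algebra.Properties.CommutativeSemigroup +-commutativeSemigroup using (interchange; xy∙z≈y∙xz)
open import Relation.Nullary using (¬_; contradiction)

-- Valid positions

data Level : Set where
  bottom top : Level

other : Level → Level
other bottom = top
other top    = bottom

altitude : Level → ℤ
altitude bottom = + 0
altitude top    = + 1

climb : Level → Dir
climb bottom = N
climb top    = S

-- Admissible h v ds : ds is a valid continuation of an arm whose last joint is at
-- altitude h and whose last link is vertical iff v; a vertical link must leave its
-- level towards the other one and be followed by a horizontal link.
data Admissible : ∀ {m} → Level → Bool → Vec Dir m → Set where
  []    : ∀ {h v} → Admissible h v []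
  east  : ∀ {m h v} {ds : Vec Dir m} → Admissible h false ds → Admissible h v (E ∷ ds)
  north : ∀ {m} {ds : Vec Dir m} → Admissible top true ds → Admissible bottom false (N ∷ ds)
  south : ∀ {m} {ds : Vec Dir m} → Admissible bottom true ds → Admissible top false (S ∷ ds)

admissible-relax : ∀ {m h v} {ds : Vec Dir m} → Admissible h true ds → Admissible h v ds
admissible-relax []       = []
admissible-relax (east a) = east a

points-head : ∀ {m} {P : Point → Set} {p} (ds : Vec Dir m) → All P (points p ds) → P p
points-head []      (px ∷ _) = px
points-head (_ ∷ _) (px ∷ _) = px

altitude-inStrip : ∀ {n k} h → k ≤ n → InStrip n (+ k , altitude h)
altitude-inStrip bottom k≤n = (+≤+ z≤n , +≤+ k≤n) , (+≤+ z≤n , +≤+ z≤n)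
altitude-inStrip top    k≤n = (+≤+ z≤n , +≤+ k≤n) , (+≤+ z≤n , +≤+ (s≤s z≤n))

admissible⇒inStrip : ∀ {n m h v k} {ds : Vec Dir m} → Admissible h v ds → k + m ≤ n →
                     All (InStrip n) (points (+ k , altitude h) ds)
admissible⇒inStrip {h = h} {k = k} [] le = altitude-inStrip h (≤-trans (m≤m+n k 0) le) ∷ []
admissible⇒inStrip {n} {suc m} {h} {k = k} (east a) le =
  altitude-inStrip h (≤-trans (m≤m+n k _) le) ∷ admissible⇒inStrip a (≤-trans (≤-reflexive (+-assoc k 1 m)) le)
admissible⇒inStrip {n} {suc m} {k = k} (north a) le =
  altitude-inStrip bottom (≤-trans (m≤m+n k _) le) ∷ admissible⇒inStrip a (≤-trans (+-monoʳ-≤ k (n≤1+n m)) le)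
admissible⇒inStrip {n} {suc m} {k = k} (south a) le =
  altitude-inStrip top (≤-trans (m≤m+n k _) le) ∷ admissible⇒inStrip a (≤-trans (+-monoʳ-≤ k (n≤1+n m)) le)

EastOf : ℕ → Point → Set
EastOf j p = + j ℤ.≤ proj₁ p

points-eastOf : ∀ {m j k y} (ds : Vec Dir m) → j ≤ k → All (EastOf j) (points (+ k , y) ds)
points-eastOf []       j≤k = +≤+ j≤k ∷ []
points-eastOf (E ∷ ds) j≤k = +≤+ j≤k ∷ points-eastOf ds (≤-trans j≤k (m≤m+n _ 1))
points-eastOf (N ∷ ds) j≤k = +≤+ j≤k ∷ points-eastOf ds j≤k
points-eastOf (S ∷ ds) j≤k = +≤+ j≤k ∷ points-eastOf ds j≤k

points-east-≢ : ∀ {m k y y′} (ds : Vec Dir m) → All ((+ k , y) ≢_) (points (+ (k + 1) , y′) ds)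
points-east-≢ {k = k} ds = All.map strictlyEast (points-eastOf ds (≤-reflexive (+-comm 1 k)))
  where
  strictlyEast : ∀ {y p} → EastOf (suc k) p → (+ k , y) ≢ p
  strictlyEast (+≤+ k<k) refl = 1+n≰n k<k

other-≢ : ∀ {k} h → _≢_ {A = Point} (+ k , altitude (other h)) (+ k , altitude h)
other-≢ bottom ()
other-≢ top    ()

points-vertical-≢ : ∀ {m h k} {ds : Vec Dir m} → Admissible h true ds →
                    All ((+ k , altitude (other h)) ≢_) (points (+ k , altitude h) ds)
points-vertical-≢ {h = h} []                     = other-≢ h ∷ []
points-vertical-≢ {h = h} {ds = _ ∷ ds} (east a) = other-≢ h ∷ points-east-≢ ds

admissible⇒unique : ∀ {m h v k} {ds : Vec Dir m} → Admissible h v ds → Unique (points (+ k , altitude h) ds)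
admissible⇒unique []                     = [] ∷ []
admissible⇒unique {ds = _ ∷ ds} (east a) = points-east-≢ ds ∷ admissible⇒unique a
admissible⇒unique (north a)              = points-vertical-≢ a ∷ admissible⇒unique a
admissible⇒unique (south a)              = points-vertical-≢ a ∷ admissible⇒unique a

admissible⇒valid : ∀ {n} {ds : Vec Dir n} → Admissible bottom false ds → Valid n ds
admissible⇒valid a = admissible⇒inStrip a ≤-refl , admissible⇒unique a

above-strip : ∀ {n x} → ¬ InStrip n (x , + 2)
above-strip (_ , _ , +≤+ (s≤s ()))

below-strip : ∀ {n x} → ¬ InStrip n (x , ℤ.-[1+ 0 ])
below-strip (_ , () , _)

inStrip∧unique⇒admissible : ∀ {n m h k} (ds : Vec Dir m) →
  All (InStrip n) (points (+ k , altitude h) ds) → Unique (points (+ k , altitude h) ds) → Admissible h false ds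
inStrip∧unique⇒admissible [] _ _ = []
inStrip∧unique⇒admissible (E ∷ ds) (_ ∷ s) (_ ∷ u) = east (inStrip∧unique⇒admissible ds s u)
inStrip∧unique⇒admissible {h = bottom} (N ∷ []) _ _ = north []
inStrip∧unique⇒admissible {h = bottom} (N ∷ E ∷ ds) (_ ∷ _ ∷ s) (_ ∷ _ ∷ u) =
  north (east (inStrip∧unique⇒admissible ds s u))
inStrip∧unique⇒admissible {h = bottom} (N ∷ N ∷ ds) (_ ∷ _ ∷ s) _ = ⊥-elim (above-strip (points-head ds s))
inStrip∧unique⇒admissible {h = bottom} (N ∷ S ∷ ds) _ ((_ ∷ ≢start) ∷ _) = ⊥-elim (points-head ds ≢start refl)
inStrip∧unique⇒admissible {h = top} (N ∷ ds) (_ ∷ s) _ = ⊥-elim (above-strip (points-head ds s))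
inStrip∧unique⇒admissible {h = top} (S ∷ []) _ _ = south []
inStrip∧unique⇒admissible {h = top} (S ∷ E ∷ ds) (_ ∷ _ ∷ s) (_ ∷ _ ∷ u) =
  south (east (inStrip∧unique⇒admissible ds s u))
inStrip∧unique⇒admissible {h = top} (S ∷ S ∷ ds) (_ ∷ _ ∷ s) _ = ⊥-elim (below-strip (points-head ds s))
inStrip∧unique⇒admissible {h = top} (S ∷ N ∷ ds) _ ((_ ∷ ≢start) ∷ _) = ⊥-elim (points-head ds ≢start refl)
inStrip∧unique⇒admissible {h = bottom} (S ∷ ds) (_ ∷ s) _ = ⊥-elim (below-strip (points-head ds s))

valid⇒admissible : ∀ {n} {ds : Vec Dir n} → Valid n ds → Admissible bottom false ds
valid⇒admissible {ds = ds} (s , u) = inStrip∧unique⇒admissible ds s u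

-- Profiles, rank and moves

vert : Dir → ℕ
vert E = 0
vert N = 1
vert S = 1

profile : ∀ {m} → Vec Dir m → ℕ → ℕ
profile []       _       = 0
profile (_ ∷ _)  zero    = 0
profile (d ∷ ds) (suc x) = vert d + profile ds x

profile-zero : ∀ {m} (ds : Vec Dir m) → profile ds 0 ≡ 0
profile-zero []      = refl
profile-zero (_ ∷ _) = refl

_≼_ : ∀ {m} → Vec Dir m → Vec Dir m → Set
p ≼ q = ∀ x → profile p x ≤ profile q x

≼-trans : ∀ {m} {p q r : Vec Dir m} → p ≼ q → q ≼ r → p ≼ r
≼-trans p≼q q≼r x = ≤-trans (p≼q x) (q≼r x)

≼-cons : ∀ {m} d {p q : Vec Dir m} → p ≼ q → (d ∷ p) ≼ (d ∷ q)
≼-cons d p≼q zero    = z≤n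
≼-cons d p≼q (suc x) = +-monoʳ-≤ (vert d) (p≼q x)

sumBelow : ℕ → (ℕ → ℕ) → ℕ
sumBelow zero    f = 0
sumBelow (suc k) f = f 0 + sumBelow k (f ∘ suc)

sumBelow-mono : ∀ k {f g} → (∀ x → f x ≤ g x) → sumBelow k f ≤ sumBelow k g
sumBelow-mono zero    f≤g = z≤n
sumBelow-mono (suc k) f≤g = +-mono-≤ (f≤g 0) (sumBelow-mono k (f≤g ∘ suc))

sumBelow-+ : ∀ k c f → sumBelow k (λ x → c + f x) ≡ k * c + sumBelow k f
sumBelow-+ zero    c f = refl
sumBelow-+ (suc k) c f = begin
  c + f 0 + sumBelow k (λ x → c + f (suc x))  ≡⟨ cong (λ s → c + f 0 + s) (sumBelow-+ k c (f ∘ suc)) ⟩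
  c + f 0 + (k * c + sumBelow k (f ∘ suc))    ≡⟨ interchange c (f 0) (k * c) _ ⟩
  c + k * c + (f 0 + sumBelow k (f ∘ suc))    ∎
  where open ≡-Reasoning

rank : ∀ {m} → Vec Dir m → ℕ
rank {m} ds = sumBelow (suc m) (profile ds)

rank-mono : ∀ {m} {p q : Vec Dir m} → p ≼ q → rank p ≤ rank q
rank-mono {m} = sumBelow-mono (suc m)

rank-cons : ∀ {m} d (ds : Vec Dir m) → rank (d ∷ ds) ≡ suc m * vert d + rank ds
rank-cons {m} d ds = sumBelow-+ (suc m) (vert d) (profile ds)

_⋖_ : ∀ {m} → Vec Dir m → Vec Dir m → Set
p ⋖ q = p ≼ q × rank q ≡ suc (rank p)

⋖-cons : ∀ {m} d {p q : Vec Dir m} → p ⋖ q → (d ∷ p) ⋖ (d ∷ q)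
⋖-cons {m} d {p} {q} (p≼q , rq) = ≼-cons d p≼q , (begin
  rank (d ∷ q)                  ≡⟨ rank-cons d q ⟩
  suc m * vert d + rank q       ≡⟨ cong (λ r → suc m * vert d + r) rq ⟩
  suc m * vert d + suc (rank p) ≡⟨ +-suc _ (rank p) ⟩
  suc (suc m * vert d + rank p) ≡⟨ cong suc (rank-cons d p) ⟨
  suc (rank (d ∷ p))            ∎)
  where open ≡-Reasoning

⋖-rotate : ∀ h → (E ∷ []) ⋖ (climb h ∷ [])
⋖-rotate bottom = (λ { zero → z≤n ; (suc x) → z≤n }) , refl
⋖-rotate top    = (λ { zero → z≤n ; (suc x) → z≤n }) , refl

⋖-swap : ∀ h {m} (ds : Vec Dir m) → (E ∷ climb h ∷ ds) ⋖ (climb h ∷ E ∷ ds)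
⋖-swap bottom ds = (λ { zero → z≤n ; (suc zero) → z≤n ; (suc (suc x)) → ≤-refl }) , refl
⋖-swap top    ds = (λ { zero → z≤n ; (suc zero) → z≤n ; (suc (suc x)) → ≤-refl }) , refl

admissible-tail : ∀ {m h v d} {ds : Vec Dir m} → Admissible h v (d ∷ ds) → ∃₂ λ h′ v′ → Admissible h′ v′ ds
admissible-tail (east a)  = _ , _ , a
admissible-tail (north a) = _ , _ , a
admissible-tail (south a) = _ , _ , a

move-covers : ∀ {m h v} {p w : Vec Dir m} → Admissible h v p → Move p w → p ⋖ w ⊎ w ⋖ p
move-covers {p = E ∷ N ∷ ds} _ (inj₁ (here _))   = inj₁ (⋖-swap bottom ds)
move-covers {p = E ∷ S ∷ ds} _ (inj₁ (here _))   = inj₁ (⋖-swap top ds)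
move-covers {p = N ∷ E ∷ ds} _ (inj₁ (here _))   = inj₂ (⋖-swap bottom ds)
move-covers {p = S ∷ E ∷ ds} _ (inj₁ (here _))   = inj₂ (⋖-swap top ds)
move-covers {p = N ∷ S ∷ _} (north ()) (inj₁ (here _))
move-covers {p = S ∷ N ∷ _} (south ()) (inj₁ (here _))
move-covers {p = E ∷ E ∷ _} _ (inj₁ (here d≢d)) = ⊥-elim (d≢d refl)
move-covers {p = N ∷ N ∷ _} _ (inj₁ (here d≢d)) = ⊥-elim (d≢d refl)
move-covers {p = S ∷ S ∷ _} _ (inj₁ (here d≢d)) = ⊥-elim (d≢d refl)
move-covers _ (inj₂ (here EN)) = inj₁ (⋖-rotate bottom)
move-covers _ (inj₂ (here ES)) = inj₁ (⋖-rotate top)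
move-covers _ (inj₂ (here NE)) = inj₂ (⋖-rotate bottom)
move-covers _ (inj₂ (here SE)) = inj₂ (⋖-rotate top)
move-covers {p = d ∷ _} a (inj₁ (there s)) =
  Sum.map (⋖-cons d) (⋖-cons d) (move-covers (proj₂ (proj₂ (admissible-tail a))) (inj₁ s))
move-covers {p = d ∷ _} a (inj₂ (there r)) =
  Sum.map (⋖-cons d) (⋖-cons d) (move-covers (proj₂ (proj₂ (admissible-tail a))) (inj₂ r))

move-cons : ∀ {m} d {p w : Vec Dir m} → Move p w → Move (d ∷ p) (d ∷ w)
move-cons d = Sum.map there there

-- Moving the first vertical link of t one step west (raising the last link if t has
-- none) is an upward move from E ∷ t; it raises the profile only where it was 0, to 1.
shift-first-vertical : ∀ {m h} {t : Vec Dir m} → Admissible h false t →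
  ∃[ w ] (Move (E ∷ t) w × Admissible h false w × (E ∷ t) ⋖ w × (∀ x → profile w x ≤ profile (E ∷ t) x ⊔ (1 ⊓ x)))
shift-first-vertical {h = bottom} [] =
  N ∷ [] , inj₂ (here EN) , north [] , ⋖-rotate bottom , λ { zero → z≤n ; (suc x) → ≤-refl }
shift-first-vertical {h = top} [] =
  S ∷ [] , inj₂ (here ES) , south [] , ⋖-rotate top , λ { zero → z≤n ; (suc x) → ≤-refl }
shift-first-vertical {t = E ∷ t} (east a) with shift-first-vertical a
... | w , mv , aw , cov , bound = E ∷ w , move-cons E mv , east aw , ⋖-cons E cov ,
  λ { zero → z≤n ; (suc x) → ≤-trans (bound x) (⊔-monoʳ-≤ (profile (E ∷ t) x) (m⊓n≤m 1 x)) }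
shift-first-vertical {t = N ∷ t} (north a) =
  N ∷ E ∷ t , inj₁ (here λ ()) , north (east (admissible-relax a)) , ⋖-swap bottom t ,
  λ { zero → z≤n ; (suc zero) → ≤-refl ; (suc (suc x)) → m≤m⊔n _ 1 }
shift-first-vertical {t = S ∷ t} (south a) =
  S ∷ E ∷ t , inj₁ (here λ ()) , south (east (admissible-relax a)) , ⋖-swap top t ,
  λ { zero → z≤n ; (suc zero) → ≤-refl ; (suc (suc x)) → m≤m⊔n _ 1 }

climb-head-profile : ∀ h {m} (q : Vec Dir m) x → 1 ⊓ x ≤ profile (climb h ∷ q) x
climb-head-profile _      _ zero    = z≤n
climb-head-profile bottom _ (suc x) = s≤s z≤n
climb-head-profile top    _ (suc x) = s≤s z≤n

StepTowards : ∀ {m} → Level → Bool → Vec Dir m → Vec Dir m → Set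
StepTowards h v p q = ∃[ w ] (Move p w × Admissible h v w × p ⋖ w × w ≼ q)

step-cons : ∀ {m h v h′ v′} d {p q : Vec Dir m} → (∀ {w} → Admissible h′ v′ w → Admissible h v (d ∷ w)) →
            StepTowards h′ v′ p q → StepTowards h v (d ∷ p) (d ∷ q)
step-cons d adm (w , mv , aw , cov , w≼q) = d ∷ w , move-cons d mv , adm aw , ⋖-cons d cov , ≼-cons d w≼q

≼⇒≡⊎step : ∀ {m h v} {p q : Vec Dir m} → Admissible h v p → Admissible h v q → p ≼ q → p ≡ q ⊎ StepTowards h v p q
≼⇒≡⊎step [] [] _ = inj₁ refl
≼⇒≡⊎step (east a) (east b) p≼q =
  Sum.map (cong (E ∷_)) (step-cons E east) (≼⇒≡⊎step a b (p≼q ∘ suc))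
≼⇒≡⊎step (north a) (north b) p≼q =
  Sum.map (cong (N ∷_)) (step-cons N north) (≼⇒≡⊎step a b (s≤s⁻¹ ∘ p≼q ∘ suc))
≼⇒≡⊎step (south a) (south b) p≼q =
  Sum.map (cong (S ∷_)) (step-cons S south) (≼⇒≡⊎step a b (s≤s⁻¹ ∘ p≼q ∘ suc))
≼⇒≡⊎step (east a) (north {ds = q} b) p≼q with shift-first-vertical a
... | w , mv , aw , cov , bound =
  inj₂ (w , mv , aw , cov , λ x → ≤-trans (bound x) (⊔-lub (p≼q x) (climb-head-profile bottom q x)))
≼⇒≡⊎step (east a) (south {ds = q} b) p≼q with shift-first-vertical a
... | w , mv , aw , cov , bound =
  inj₂ (w , mv , aw , cov , λ x → ≤-trans (bound x) (⊔-lub (p≼q x) (climb-head-profile top q x)))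
≼⇒≡⊎step (north _) (east {ds = q} _) p≼q = contradiction (≤-trans (p≼q 1) (≤-reflexive (profile-zero q))) λ ()
≼⇒≡⊎step (south _) (east {ds = q} _) p≼q = contradiction (≤-trans (p≼q 1) (≤-reflexive (profile-zero q))) λ ()

≼-antisym : ∀ {m h v} {p q : Vec Dir m} → Admissible h v p → Admissible h v q → p ≼ q → q ≼ p → p ≡ q
≼-antisym {p = p} {q} ap aq p≼q q≼p with ≼⇒≡⊎step ap aq p≼q
... | inj₁ p≡q = p≡q
... | inj₂ (w , _ , _ , (_ , rw) , w≼q) = ⊥-elim (1+n≰n (begin
  suc (rank p) ≡⟨ rw ⟨
  rank w       ≤⟨ rank-mono {p = w} {q} w≼q ⟩
  rank q       ≤⟨ rank-mono {p = q} {p} q≼p ⟩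
  rank p       ∎))
  where open ≤-Reasoning

-- Walks and the order ≤H

walk-rank : ∀ {n b} {p q : Vec Dir n} → Valid n p → Walk p q b → rank q ≤ rank p + b
walk-rank {p = p} _ stay = ≤-reflexive (sym (+-identityʳ (rank p)))
walk-rank {b = suc b} {p} {q} vp (move {w = w} mv vw wk) = begin
  rank q           ≤⟨ walk-rank vw wk ⟩
  rank w + b       ≤⟨ +-monoˡ-≤ b (moved-rank (move-covers (valid⇒admissible vp) mv)) ⟩
  suc (rank p) + b ≡⟨ +-suc (rank p) b ⟨
  rank p + suc b   ∎
  where
  open ≤-Reasoning
  moved-rank : p ⋖ w ⊎ w ⋖ p → rank w ≤ suc (rank p)
  moved-rank (inj₁ (_ , rw)) = ≤-reflexive rw
  moved-rank (inj₂ (_ , rp)) = ≤-trans (n≤1+n (rank w)) (≤-trans (≤-reflexive (sym rp)) (n≤1+n (rank p)))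

geodesic⇒≼ : ∀ {n b} {p q : Vec Dir n} → Valid n p → Walk p q b → rank p + b ≡ rank q → p ≼ q
geodesic⇒≼ _ stay _ x = ≤-refl
geodesic⇒≼ {b = suc b} {p} {q} vp (move {w = w} mv vw wk) tight with move-covers (valid⇒admissible vp) mv
... | inj₁ (p≼w , rw) = ≼-trans {p = p} {w} {q} p≼w (geodesic⇒≼ vw wk (trans (cong (_+ b) rw) (trans (sym (+-suc (rank p) b)) tight)))
... | inj₂ (_ , rp) = ⊥-elim (<⇒≱ too-far (walk-rank vw wk))
  where
  too-far : rank w + b < rank q
  too-far = begin-strict
    rank w + b             <⟨ n<1+n (rank w + b) ⟩
    suc (rank w + b)       ≤⟨ n≤1+n _ ⟩
    suc (suc (rank w + b)) ≡⟨ cong suc (+-suc (rank w) b) ⟨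
    suc (rank w + suc b)   ≡⟨ cong (_+ suc b) rp ⟨
    rank p + suc b         ≡⟨ tight ⟩
    rank q                 ∎
    where open ≤-Reasoning

≼⇒walk : ∀ {n} d {p q : Vec Dir n} → Admissible bottom false p → Admissible bottom false q →
         p ≼ q → rank p + d ≡ rank q → Walk p q d
≼⇒walk d ap aq p≼q tight with ≼⇒≡⊎step ap aq p≼q
≼⇒walk zero    ap aq p≼q tight | inj₁ refl = stay
≼⇒walk (suc d) {p} ap aq p≼q tight | inj₁ refl = ⊥-elim (m+1+n≢m (rank p) tight)
≼⇒walk zero    {p} {q} ap aq p≼q tight | inj₂ (w , _ , _ , (_ , rw) , w≼q) = ⊥-elim (1+n≰n (begin
  suc (rank p) ≡⟨ rw ⟨
  rank w       ≤⟨ rank-mono {p = w} {q} w≼q ⟩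
  rank q       ≡⟨ tight ⟨
  rank p + 0   ≡⟨ +-identityʳ (rank p) ⟩
  rank p       ∎))
  where open ≤-Reasoning
≼⇒walk (suc d) {p} ap aq p≼q tight | inj₂ (w , mv , aw , (_ , rw) , w≼q) =
  move mv (admissible⇒valid aw) (≼⇒walk d aw aq w≼q (trans (cong (_+ d) rw) (trans (sym (+-suc (rank p) d)) tight)))

horizontal-admissible : ∀ {h v} m → Admissible h v (horizontal m)
horizontal-admissible zero    = []
horizontal-admissible (suc m) = east (horizontal-admissible m)

profile-horizontal : ∀ m x → profile (horizontal m) x ≡ 0
profile-horizontal zero    x       = refl
profile-horizontal (suc m) zero    = refl
profile-horizontal (suc m) (suc x) = profile-horizontal m x

horizontal-≼ : ∀ {m} (q : Vec Dir m) → horizontal m ≼ q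
horizontal-≼ {m} q x = ≤-trans (≤-reflexive (profile-horizontal m x)) z≤n

rank-horizontal : ∀ m → rank (horizontal m) ≡ 0
rank-horizontal zero    = refl
rank-horizontal (suc m) = trans (rank-cons E (horizontal m)) (cong₂ _+_ (*-zeroʳ (suc m)) (rank-horizontal m))

rank≤distance : ∀ {n k} {q : Vec Dir n} → Walk (horizontal n) q k → rank q ≤ k
rank≤distance {n} {k} wk =
  ≤-trans (walk-rank (admissible⇒valid (horizontal-admissible n)) wk) (≤-reflexive (cong (_+ k) (rank-horizontal n)))

walk-from-horizontal : ∀ {n} {q : Vec Dir n} → Admissible bottom false q → Walk (horizontal n) q (rank q)
walk-from-horizontal {n} {q} aq =
  ≼⇒walk (rank q) (horizontal-admissible n) aq (horizontal-≼ q) (cong (_+ rank q) (rank-horizontal n))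

≤H⇒≼ : ∀ {n} {s t : State n} → s ≤H t → proj₁ s ≼ proj₁ t
≤H⇒≼ {s = p , vp} {q , vq} (a , b , wp , wpq , shortest) = geodesic⇒≼ vp wpq (≤-antisym
  (begin
    rank p + b ≤⟨ +-monoˡ-≤ b (rank≤distance wp) ⟩
    a + b      ≤⟨ shortest (rank q) (walk-from-horizontal (valid⇒admissible vq)) ⟩
    rank q     ∎)
  (walk-rank vp wpq))
  where open ≤-Reasoning

≼⇒≤H : ∀ {n} {s t : State n} → proj₁ s ≼ proj₁ t → s ≤H t
≼⇒≤H {s = p , vp} {q , vq} p≼q =
  rank p , rank q ∸ rank p , walk-from-horizontal ap , ≼⇒walk _ ap aq p≼q p+[q∸p]≡q ,
  λ k wk → ≤-trans (≤-reflexive p+[q∸p]≡q) (rank≤distance wk)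
  where
  ap : Admissible bottom false p
  ap = valid⇒admissible vp
  aq : Admissible bottom false q
  aq = valid⇒admissible vq
  p+[q∸p]≡q : rank p + (rank q ∸ rank p) ≡ rank q
  p+[q∸p]≡q = m+[n∸m]≡n (rank-mono {p = p} {q} p≼q)

-- The lattice of profiles

record IsProfile (f : ℕ → ℕ) : Set where
  field
    increasing : ∀ x → f x ≤ f (suc x)
    unit-step  : ∀ x → f (suc x) ≤ suc (f x)
    spread     : ∀ x → f (suc (suc x)) ≤ suc (f x)

  flat-or-rise : ∀ x → f (suc x) ≡ f x ⊎ f (suc x) ≡ suc (f x)
  flat-or-rise x with m≤n⇒m<n∨m≡n (unit-step x)
  ... | inj₁ f[1+x]<1+f[x] = inj₁ (≤-antisym (s≤s⁻¹ f[1+x]<1+f[x]) (increasing x))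
  ... | inj₂ rise          = inj₂ rise

open IsProfile

isProfile-suc : ∀ {f} → IsProfile f → IsProfile (f ∘ suc)
isProfile-suc pf = record
  { increasing = increasing pf ∘ suc ; unit-step = unit-step pf ∘ suc ; spread = spread pf ∘ suc }

vert≤1 : ∀ d → vert d ≤ 1
vert≤1 E = z≤n
vert≤1 N = ≤-refl
vert≤1 S = ≤-refl

profile-increasing : ∀ {m} (ds : Vec Dir m) x → profile ds x ≤ profile ds (suc x)
profile-increasing []       x       = z≤n
profile-increasing (d ∷ ds) zero    = z≤n
profile-increasing (d ∷ ds) (suc x) = +-monoʳ-≤ (vert d) (profile-increasing ds x)

profile-unit-step : ∀ {m} (ds : Vec Dir m) x → profile ds (suc x) ≤ suc (profile ds x)
profile-unit-step []       x       = z≤n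
profile-unit-step (d ∷ ds) zero    = begin
  vert d + profile ds 0 ≡⟨ cong (_+_ (vert d)) (profile-zero ds) ⟩
  vert d + 0            ≡⟨ +-identityʳ (vert d) ⟩
  vert d                ≤⟨ vert≤1 d ⟩
  1                     ∎
  where open ≤-Reasoning
profile-unit-step (d ∷ ds) (suc x) =
  ≤-trans (+-monoʳ-≤ (vert d) (profile-unit-step ds x)) (≤-reflexive (+-suc (vert d) (profile ds x)))

profile-after-vertical : ∀ {m h} {ds : Vec Dir m} → Admissible h true ds → profile ds 1 ≡ 0
profile-after-vertical []                    = refl
profile-after-vertical {ds = _ ∷ ds} (east _) = profile-zero ds

profile-spread : ∀ {m h v} {ds : Vec Dir m} → Admissible h v ds → ∀ x → profile ds (suc (suc x)) ≤ suc (profile ds x)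
profile-spread []                     x       = z≤n
profile-spread {ds = E ∷ ds} (east _) zero    =
  subst (λ z → profile ds 1 ≤ suc z) (profile-zero ds) (profile-unit-step ds 0)
profile-spread (north a)              zero    = s≤s (≤-reflexive (profile-after-vertical a))
profile-spread (south a)              zero    = s≤s (≤-reflexive (profile-after-vertical a))
profile-spread (east a)               (suc x) = profile-spread a x
profile-spread (north a)              (suc x) = s≤s (profile-spread a x)
profile-spread (south a)              (suc x) = s≤s (profile-spread a x)

isProfile-profile : ∀ {m h v} {ds : Vec Dir m} → Admissible h v ds → IsProfile (profile ds)
isProfile-profile {ds = ds} a = record
  { increasing = profile-increasing ds ; unit-step = profile-unit-step ds ; spread = profile-spread a }

levelAfter : ℕ → Level
levelAfter zero    = bottom
levelAfter (suc k) = other (levelAfter k)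

-- The link from a prefix with a vertical links to one with b; only b ∈ {a, 1 + a} matter.
link : Level → ℕ → ℕ → Dir
link h zero    (suc _) = climb h
link h (suc a) (suc b) = link h a b
link _ _       _       = E

link-flat : ∀ h a → link h a a ≡ E
link-flat h zero    = refl
link-flat h (suc a) = link-flat h a

link-rise : ∀ h a → link h a (suc a) ≡ climb h
link-rise h zero    = refl
link-rise h (suc a) = link-rise h a

fromProfile : ∀ m → (ℕ → ℕ) → Vec Dir m
fromProfile zero    f = []
fromProfile (suc m) f = link (levelAfter (f 0)) (f 0) (f 1) ∷ fromProfile m (f ∘ suc)

vert-climb : ∀ h → vert (climb h) ≡ 1
vert-climb bottom = refl
vert-climb top    = refl

vert-link : ∀ h a b → b ≡ a ⊎ b ≡ suc a → vert (link h a b) + a ≡ b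
vert-link h a .a       (inj₁ refl) = cong (λ d → vert d + a) (link-flat h a)
vert-link h a .(suc a) (inj₂ refl) = trans (cong (λ d → vert d + a) (link-rise h a)) (cong (_+ a) (vert-climb h))

profile-fromProfile : ∀ m {f} → IsProfile f → ∀ x → profile (fromProfile m f) x + f 0 ≡ f (x ⊓ m)
profile-fromProfile zero    {f} pf x       = cong f (sym (⊓-zeroʳ x))
profile-fromProfile (suc m)     pf zero    = refl
profile-fromProfile (suc m) {f} pf (suc x) = begin
  vert d + profile ds x + f 0   ≡⟨ xy∙z≈y∙xz (vert d) (profile ds x) (f 0) ⟩
  profile ds x + (vert d + f 0) ≡⟨ cong (_+_ (profile ds x)) (vert-link _ (f 0) (f 1) (flat-or-rise pf 0)) ⟩
  profile ds x + f 1            ≡⟨ profile-fromProfile m (isProfile-suc pf) x ⟩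
  f (suc (x ⊓ m))               ∎
  where
  open ≡-Reasoning
  d : Dir
  d = link (levelAfter (f 0)) (f 0) (f 1)
  ds : Vec Dir m
  ds = fromProfile m (f ∘ suc)

climb-admissible : ∀ h {m} {ds : Vec Dir m} → Admissible (other h) true ds → Admissible h false (climb h ∷ ds)
climb-admissible bottom = north
climb-admissible top    = south

fromProfile-flat : ∀ m {f h v} → f 1 ≡ f 0 → Admissible h false (fromProfile m (f ∘ suc)) →
                   Admissible h v (fromProfile (suc m) f)
fromProfile-flat m {f} {h} {v} flat a =
  subst (λ d → Admissible h v (d ∷ fromProfile m (f ∘ suc))) (sym (trans (cong (link _ (f 0)) flat) (link-flat _ (f 0)))) (east a)

fromProfile-admissible : ∀ m {f h} → IsProfile f → levelAfter (f 0) ≡ h → Admissible h false (fromProfile m f)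
fromProfile-admissible zero pf lv = []
fromProfile-admissible (suc m) {f} {h} pf lv with flat-or-rise pf 0
... | inj₁ flat = fromProfile-flat m {f} flat (fromProfile-admissible m (isProfile-suc pf) (trans (cong levelAfter flat) lv))
... | inj₂ rise =
  subst (λ d → Admissible h false (d ∷ fromProfile m (f ∘ suc)))
        (sym (trans (cong (link _ (f 0)) rise) (trans (link-rise _ (f 0)) (cong climb lv))))
        (climb-admissible h (after-rise m))
  where
  flat₂ : f 2 ≡ f 1
  flat₂ = ≤-antisym (≤-trans (spread pf 0) (≤-reflexive (sym rise))) (increasing pf 1)
  after-rise : ∀ k → Admissible (other h) true (fromProfile k (f ∘ suc))
  after-rise zero    = []
  after-rise (suc k) = fromProfile-flat k {f ∘ suc} flat₂
    (fromProfile-admissible k (isProfile-suc (isProfile-suc pf)) (trans (cong levelAfter (trans flat₂ rise)) (cong other lv)))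

profile-saturates : ∀ {m} (ds : Vec Dir m) x → profile ds (x ⊓ m) ≡ profile ds x
profile-saturates []       x       = refl
profile-saturates (d ∷ ds) zero    = refl
profile-saturates (d ∷ ds) (suc x) = cong (_+_ (vert d)) (profile-saturates ds x)

profileₛ : ∀ {n} → State n → ℕ → ℕ
profileₛ s = profile (proj₁ s)

admissibleₛ : ∀ {n} (s : State n) → Admissible bottom false (proj₁ s)
admissibleₛ s = valid⇒admissible (proj₂ s)

≈S-from-profiles : ∀ {n} {s t : State n} → (∀ x → profileₛ s x ≡ profileₛ t x) → s ≈S t
≈S-from-profiles {s = s} {t} eq =
  ≼-antisym (admissibleₛ s) (admissibleₛ t) (≤-reflexive ∘ eq) (≤-reflexive ∘ sym ∘ eq)

module Pointwise (_●_ : ℕ → ℕ → ℕ)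
                 (●-mono : ∀ {a b c d} → a ≤ b → c ≤ d → a ● c ≤ b ● d)
                 (●-suc : ∀ a b → suc a ● suc b ≡ suc (a ● b))
                 (●-zero : 0 ● 0 ≡ 0) where

  isProfile-● : ∀ {f g} → IsProfile f → IsProfile g → IsProfile (λ x → f x ● g x)
  isProfile-● pf pg = record
    { increasing = λ x → ●-mono (increasing pf x) (increasing pg x)
    ; unit-step  = λ x → ≤-trans (●-mono (unit-step pf x) (unit-step pg x)) (≤-reflexive (●-suc _ _))
    ; spread     = λ x → ≤-trans (●-mono (spread pf x) (spread pg x)) (≤-reflexive (●-suc _ _))
    }

  module _ {n : ℕ} (s t : State n) where

    combined : ℕ → ℕ
    combined x = profileₛ s x ● profileₛ t x

    combined-zero : combined 0 ≡ 0
    combined-zero = trans (cong₂ _●_ (profile-zero (proj₁ s)) (profile-zero (proj₁ t))) ●-zero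

    isProfile-combined : IsProfile combined
    isProfile-combined = isProfile-● (isProfile-profile (admissibleₛ s)) (isProfile-profile (admissibleₛ t))

    pointwise : State n
    pointwise = fromProfile n combined ,
      admissible⇒valid (fromProfile-admissible n isProfile-combined (cong levelAfter combined-zero))

    profile-pointwise : ∀ x → profileₛ pointwise x ≡ combined x
    profile-pointwise x = begin
      profileₛ pointwise x               ≡⟨ +-identityʳ _ ⟨
      profileₛ pointwise x + 0           ≡⟨ cong (_+_ (profileₛ pointwise x)) combined-zero ⟨
      profileₛ pointwise x + combined 0  ≡⟨ profile-fromProfile n isProfile-combined x ⟩
      combined (x ⊓ n)                   ≡⟨ cong₂ _●_ (profile-saturates (proj₁ s) x) (profile-saturates (proj₁ t) x) ⟩
      combined x                         ∎
      where open ≡-Reasoning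

open Pointwise _⊔_ ⊔-mono-≤ (λ _ _ → refl) refl
  using () renaming (pointwise to _∨ₛ_; profile-pointwise to profile-∨ₛ)
open Pointwise _⊓_ ⊓-mono-≤ (λ _ _ → refl) refl
  using () renaming (pointwise to _∧ₛ_; profile-pointwise to profile-∧ₛ)

≤H-isPartialOrder : ∀ {n} → IsPartialOrder (_≈S_ {n}) _≤H_
≤H-isPartialOrder = record
  { isPreorder = record
    { isEquivalence = record { refl = refl ; sym = sym ; trans = trans }
    ; reflexive     = λ {s} {t} s≈t → ≼⇒≤H {s = s} {t} (λ x → ≤-reflexive (cong (λ v → profile v x) s≈t))
    ; trans         = λ {s} {t} {u} s≤t t≤u →
        ≼⇒≤H {s = s} {u} (≼-trans {p = proj₁ s} {proj₁ t} {proj₁ u} (≤H⇒≼ {s = s} {t} s≤t) (≤H⇒≼ {s = t} {u} t≤u))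
    }
  ; antisym = λ {s} {t} s≤t t≤s →
      ≼-antisym (admissibleₛ s) (admissibleₛ t) (≤H⇒≼ {s = s} {t} s≤t) (≤H⇒≼ {s = t} {s} t≤s)
  }

∨ₛ-supremum : ∀ {n} → Supremum (_≤H_ {n}) _∨ₛ_
∨ₛ-supremum s t =
  ≼⇒≤H {s = s} {s ∨ₛ t} (λ x → ≤-trans (m≤m⊔n _ _) (≤-reflexive (sym (profile-∨ₛ s t x)))) ,
  ≼⇒≤H {s = t} {s ∨ₛ t} (λ x → ≤-trans (m≤n⊔m _ _) (≤-reflexive (sym (profile-∨ₛ s t x)))) ,
  λ u s≤u t≤u → ≼⇒≤H {s = s ∨ₛ t} {u} (λ x →
    ≤-trans (≤-reflexive (profile-∨ₛ s t x)) (⊔-lub (≤H⇒≼ {s = s} {u} s≤u x) (≤H⇒≼ {s = t} {u} t≤u x)))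

∧ₛ-infimum : ∀ {n} → Infimum (_≤H_ {n}) _∧ₛ_
∧ₛ-infimum s t =
  ≼⇒≤H {s = s ∧ₛ t} {s} (λ x → ≤-trans (≤-reflexive (profile-∧ₛ s t x)) (m⊓n≤m _ _)) ,
  ≼⇒≤H {s = s ∧ₛ t} {t} (λ x → ≤-trans (≤-reflexive (profile-∧ₛ s t x)) (m⊓n≤n _ _)) ,
  λ u u≤s u≤t → ≼⇒≤H {s = u} {s ∧ₛ t} (λ x →
    ≤-trans (⊓-glb (≤H⇒≼ {s = u} {s} u≤s x) (≤H⇒≼ {s = u} {t} u≤t x)) (≤-reflexive (sym (profile-∧ₛ s t x))))

∧ₛ-distribˡ-∨ₛ : ∀ {n} (a b c : State n) → (a ∧ₛ (b ∨ₛ c)) ≈S ((a ∧ₛ b) ∨ₛ (a ∧ₛ c))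
∧ₛ-distribˡ-∨ₛ a b c = ≈S-from-profiles {s = a ∧ₛ (b ∨ₛ c)} {(a ∧ₛ b) ∨ₛ (a ∧ₛ c)} λ x → begin
  profileₛ (a ∧ₛ (b ∨ₛ c)) x                           ≡⟨ profile-∧ₛ a (b ∨ₛ c) x ⟩
  profileₛ a x ⊓ profileₛ (b ∨ₛ c) x                    ≡⟨ cong (_⊓_ (profileₛ a x)) (profile-∨ₛ b c x) ⟩
  profileₛ a x ⊓ (profileₛ b x ⊔ profileₛ c x)          ≡⟨ ⊓-distribˡ-⊔ (profileₛ a x) _ _ ⟩
  (profileₛ a x ⊓ profileₛ b x) ⊔ (profileₛ a x ⊓ profileₛ c x) ≡⟨ cong₂ _⊔_ (profile-∧ₛ a b x) (profile-∧ₛ a c x) ⟨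
  profileₛ (a ∧ₛ b) x ⊔ profileₛ (a ∧ₛ c) x             ≡⟨ profile-∨ₛ (a ∧ₛ b) (a ∧ₛ c) x ⟨
  profileₛ ((a ∧ₛ b) ∨ₛ (a ∧ₛ c)) x                    ∎
  where open ≡-Reasoning

corollary5p3 : ∀ (n : ℕ) → 1 ≤ n →
    ∃₂ λ (join meet : Op₂ (State n)) →
      IsDistributiveLattice (_≈S_ {n}) (_≤H_ {n}) join meet
-- SR₀ has a single state.
corollary5p3 n _ = _∨ₛ_ , _∧ₛ_ , record
  { isLattice    = record { isPartialOrder = ≤H-isPartialOrder ; supremum = ∨ₛ-supremum ; infimum = ∧ₛ-infimum }
  ; ∧-distribˡ-∨ = ∧ₛ-distribˡ-∨ₛ {n}
  }
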